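{- Let $G=(V,E)$ be a directed acyclic graph and $K\subseteq V$. Then $K$ has local relationships if and only if there exists a partition $K=K_1\sqcup\cdots\sqcup K_k$ into nonempty sets such that each $K_i$ is connected and has local relationships in $G$, and for all $i\neq j$ the sets $K_i$ and $K_j$ are d-separated by the empty set.
   Context: A trail is a sequence of pairwise distinct nodes with consecutive nodes adjacent (arc in either direction), written $v_1\sim\cdots\sim v_n$. An interior node $v_j$ is a converging connection if $v_{j-1}\to v_j\leftarrow v_{j+1}$. A set $K\subseteq V$ has local relationships if for all $v_1,v_2\in K$ such that there is a trail $v_1\sim x_1\sim\cdots\sim x_n\sim v_2$ with no converging connection and all $x_i\notin K$, the nodes $v_1,v_2$ are adjacent. A set $K_i$ is connected if the undirected graph underlying the subgraph of $G$ induced by $K_i$ is connected. Two disjoint nonempty sets $A,B$ are d-separated by the empty set if no trail from a node of $A$ to a node of $B$ is free of converging connections. -}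

module Defs where

open import Data.Nat using (ℕ)
open import Data.Bool using (Bool; T)
open import Data.Fin using (Fin)
open import Data.Fin.Subset using (Subset; _∈_; _∉_; Nonempty)
open import Data.List using (List; []; _∷_; _∷ʳ_)
open import Data.List.Relation.Unary.All using (All)
open import Data.List.Relation.Unary.Linked using (Linked)
open import Data.List.Relation.Unary.Unique.Propositional using (Unique)
open import Data.Product using (_×_; ∃)
open import Data.Sum using (_⊎_)
open import Data.Unit using (⊤)
open import Relation.Nullary using (¬_)
open import Relation.Binary.PropositionalEquality using (_≡_; _≢_)
open import Function.Bundles using (_⇔_)

Graph : ℕ → Set
Graph n = Fin n → Fin n → Bool

module _ {n : ℕ} (arc : Graph n) where

  data DPath : Fin n → Fin n → Set where
    edge : ∀ {u v} → T (arc u v) → DPath u v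
    cons : ∀ {u w v} → T (arc u w) → DPath w v → DPath u v

  Acyclic : Set
  Acyclic = ∀ v → ¬ DPath v v

  Adj : Fin n → Fin n → Set
  Adj u v = T (arc u v) ⊎ T (arc v u)

  IsTrail : List (Fin n) → Set
  IsTrail l = Unique l × Linked Adj l

  NoConverging : List (Fin n) → Set
  NoConverging (x ∷ y ∷ z ∷ rest) =
    ¬ (T (arc x y) × T (arc z y)) × NoConverging (y ∷ z ∷ rest)
  NoConverging _ = ⊤

  LocalRelationships : Subset n → Set
  LocalRelationships K =
    ∀ v₁ v₂ (xs : List (Fin n)) → v₁ ∈ K → v₂ ∈ K →
    IsTrail (v₁ ∷ xs ∷ʳ v₂) → NoConverging (v₁ ∷ xs ∷ʳ v₂) →
    All (_∉ K) xs → Adj v₁ v₂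

  data ConnIn (S : Subset n) : Fin n → Fin n → Set where
    here : ∀ {u} → ConnIn S u u
    step : ∀ {u w v} → Adj u w → w ∈ S → ConnIn S w v → ConnIn S u v

  Connected : Subset n → Set
  Connected S = ∀ u v → u ∈ S → v ∈ S → ConnIn S u v

  DSepEmpty : Subset n → Subset n → Set
  DSepEmpty A B =
    ∀ a b (xs : List (Fin n)) → a ∈ A → b ∈ B →
    IsTrail (a ∷ xs ∷ʳ b) → ¬ NoConverging (a ∷ xs ∷ʳ b)

  IsPartition : Subset n → (k : ℕ) → (Fin k → Subset n) → Set
  IsPartition K k Ks =
    (∀ i → Nonempty (Ks i)) ×
    (∀ i j v → i ≢ j → v ∈ Ks i → v ∉ Ks j) ×
    (∀ v → v ∈ K ⇔ ∃ λ i → v ∈ Ks i)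

{-# OPTIONS --safe #-}
-- If K has local relationships, two consecutive nodes of K on an active trail (one without
-- converging connections) are joined by a K-free active subtrail and are therefore adjacent.
-- Hence all nodes of K on an active trail starting in K lie in one connected component of
-- G[K], so the components inherit local relationships and are pairwise d-separated by the
-- empty set. Conversely, the ends of a K-free active trail lie in one block by d-separation,
-- and that block's local relationships make them adjacent. The components themselves are
-- computed by deciding connectivity in G[K] with a Floyd–Warshall recursion.
module Submission where

open import Level using (0ℓ)
open import Data.Nat using (ℕ; zero; suc)
open import Data.Fin using (Fin; zero; suc; _≟_)
open import Data.Fin.Properties using (any?)
open import Data.Fin.Subset using (Subset; _∈_; _∉_; Nonempty)
open import Data.Fin.Subset.Properties using (_∈?_)
open import Data.Vec.Base using ([]; _∷_; here; there)
open import Data.List using (List; []; _∷_; _∷ʳ_; _++_; allFin)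
open import Data.List.Properties using (∷ʳ-++)
open import Data.List.Membership.Propositional using () renaming (_∈_ to _∈ₗ_)
open import Data.List.Membership.Propositional.Properties using (∈-allFin)
open import Data.List.Relation.Unary.Any using (here; there)
open import Data.List.Relation.Unary.All as All using (All; []; _∷_)
import Data.List.Relation.Unary.All.Properties as All
open import Data.List.Relation.Unary.AllPairs using (AllPairs; []; _∷_)
open import Data.List.Relation.Unary.Linked using (Linked; []; [-]; _∷_)
open import Data.Product using (_×_; ∃; ∃₂; _,_; proj₁; proj₂; map₂)
open import Data.Sum using (_⊎_; inj₁; inj₂)
open import Data.Unit using (tt)
open import Data.Empty using (⊥-elim)
open import Function using (_∘_)
open import Function.Bundles using (_⇔_; mk⇔)
open Function.Bundles.Equivalence using (to; from)
open import Relation.Nullary using (¬_; Dec; yes; no; does)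
open import Relation.Nullary.Decidable using (map′; _⊎-dec_; _×-dec_; T?)
open import Relation.Unary as U using (Pred; _⊆_; _∩_)
open import Relation.Binary as B using (Rel; IsPartialEquivalence)
open import Relation.Binary.PropositionalEquality as ≡ using (_≡_; _≢_; refl; cong; subst)

open import Defs

module _ {n : ℕ} (R : Rel (Fin n) 0ℓ) where

  infixr 5 _∷⟨_⟩_

  data Walk (A : Pred (Fin n) 0ℓ) : Rel (Fin n) 0ℓ where
    [_]    : ∀ {u v} → R u v → Walk A u v
    _∷⟨_⟩_ : ∀ {u w v} → R u w → A w → Walk A w v → Walk A u v

module _ {n : ℕ} {R : Rel (Fin n) 0ℓ} where

  walk-map : ∀ {A B} → A ⊆ B → ∀ {u v} → Walk R A u v → Walk R B u v
  walk-map A⊆B [ r ]          = [ r ]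
  walk-map A⊆B (r ∷⟨ a ⟩ ws) = r ∷⟨ A⊆B a ⟩ walk-map A⊆B ws

  walk-join : ∀ {A u x v} → Walk R A u x → A x → Walk R A x v → Walk R A u v
  walk-join [ r ]          ax ws′ = r ∷⟨ ax ⟩ ws′
  walk-join (r ∷⟨ a ⟩ ws) ax ws′ = r ∷⟨ a ⟩ walk-join ws ax ws′

  -- Floyd–Warshall: cut the walk at its first and at its last visit to x.
  walk-split : ∀ {A x L u v} → Walk R (A ∩ (_∈ₗ x ∷ L)) u v →
    Walk R (A ∩ (_∈ₗ L)) u v ⊎
    (A x × Walk R (A ∩ (_∈ₗ L)) u x × Walk R (A ∩ (_∈ₗ L)) x v)
  walk-split [ r ] = inj₁ [ r ]
  walk-split (r ∷⟨ a , here refl ⟩ ws) with walk-split ws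
  ... | inj₁ ws′             = inj₂ (a , [ r ] , ws′)
  ... | inj₂ (_ , _ , ws′)   = inj₂ (a , [ r ] , ws′)
  walk-split (r ∷⟨ a , there w∈L ⟩ ws) with walk-split ws
  ... | inj₁ ws′             = inj₁ (r ∷⟨ a , w∈L ⟩ ws′)
  ... | inj₂ (ax , ws₁ , ws₂) = inj₂ (ax , r ∷⟨ a , w∈L ⟩ ws₁ , ws₂)

  module _ (R? : B.Decidable R) {A : Pred (Fin n) 0ℓ} (A? : U.Decidable A) where

    walk-via? : ∀ L → B.Decidable (Walk R (A ∩ (_∈ₗ L)))
    walk-via? [] u v = map′ [_] (λ { [ r ] → r ; (_ ∷⟨ _ , () ⟩ _) }) (R? u v)
    walk-via? (x ∷ L) u v =
      map′ unsplit walk-split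
        (walk-via? L u v ⊎-dec (A? x ×-dec (walk-via? L u x ×-dec walk-via? L x v)))
      where
      weaken : ∀ {s t} → Walk R (A ∩ (_∈ₗ L)) s t → Walk R (A ∩ (_∈ₗ x ∷ L)) s t
      weaken = walk-map (map₂ there)
      unsplit : Walk R (A ∩ (_∈ₗ L)) u v ⊎
                (A x × Walk R (A ∩ (_∈ₗ L)) u x × Walk R (A ∩ (_∈ₗ L)) x v) →
                Walk R (A ∩ (_∈ₗ x ∷ L)) u v
      unsplit (inj₁ ws)              = weaken ws
      unsplit (inj₂ (ax , ws₁ , ws₂)) = walk-join (weaken ws₁) (ax , here refl) (weaken ws₂)

    walk? : B.Decidable (Walk R A)
    walk? u v =
      map′ (walk-map proj₁) (walk-map (λ {w} a → a , ∈-allFin w)) (walk-via? (allFin n) u v)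

select : ∀ {n} {P : Pred (Fin n) 0ℓ} → U.Decidable P → Subset n
select {zero}  P? = []
select {suc n} P? = does (P? zero) ∷ select (P? ∘ suc)

∈-select : ∀ {n} {P : Pred (Fin n) 0ℓ} (P? : U.Decidable P) {v} → v ∈ select P? ⇔ P v
∈-select {suc n} P? {zero} with P? zero
... | yes p = mk⇔ (λ _ → p) (λ _ → here)
... | no ¬p = mk⇔ (λ ()) (⊥-elim ∘ ¬p)
∈-select {suc n} P? {suc v} =
  mk⇔ (λ { (there v∈) → to (∈-select (P? ∘ suc)) v∈ })
      (there ∘ from (∈-select (P? ∘ suc)))

module Classes {n : ℕ} {_≈_ : Rel (Fin n) 0ℓ}
               (isPER : IsPartialEquivalence _≈_) (_≈?_ : B.Decidable _≈_) where

  open IsPartialEquivalence isPER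

  class : Fin n → Subset n
  class r = select (r ≈?_)

  ∈-class : ∀ {r v} → v ∈ class r ⇔ r ≈ v
  ∈-class {r} = ∈-select (r ≈?_)

  record Representatives (xs : List (Fin n)) : Set where
    field
      k         : ℕ
      rep       : Fin k → Fin n
      rep-refl  : ∀ i → rep i ≈ rep i
      rep-apart : ∀ i j → i ≢ j → ¬ rep i ≈ rep j
      rep-cover : ∀ {v} → v ∈ₗ xs → v ≈ v → ∃ λ i → rep i ≈ v

  module _ {xs : List (Fin n)} (reps : Representatives xs) (x : Fin n) where
    open Representatives reps

    keep-representatives : (x ≈ x → ∃ λ i → rep i ≈ x) → Representatives (x ∷ xs)
    keep-representatives x-covered = record
      { k = k ; rep = rep ; rep-refl = rep-refl ; rep-apart = rep-apart ; rep-cover = cover′ }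
      where
      cover′ : ∀ {v} → v ∈ₗ x ∷ xs → v ≈ v → ∃ λ i → rep i ≈ v
      cover′ (here refl)  = x-covered
      cover′ (there v∈xs) = rep-cover v∈xs

    add-representative : x ≈ x → ¬ (∃ λ i → rep i ≈ x) → Representatives (x ∷ xs)
    add-representative x≈x x-new = record
      { k = suc k ; rep = rep′ ; rep-refl = refl′ ; rep-apart = apart′ ; rep-cover = cover′ }
      where
      rep′ : Fin (suc k) → Fin n
      rep′ zero    = x
      rep′ (suc i) = rep i
      refl′ : ∀ i → rep′ i ≈ rep′ i
      refl′ zero    = x≈x
      refl′ (suc i) = rep-refl i
      apart′ : ∀ i j → i ≢ j → ¬ rep′ i ≈ rep′ j
      apart′ zero    zero    i≢j _ = i≢j refl
      apart′ zero    (suc j) _   e = x-new (j , sym e)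
      apart′ (suc i) zero    _   e = x-new (i , e)
      apart′ (suc i) (suc j) i≢j e = rep-apart i j (i≢j ∘ cong suc) e
      cover′ : ∀ {v} → v ∈ₗ x ∷ xs → v ≈ v → ∃ λ i → rep′ i ≈ v
      cover′ (here refl)  _   = zero , x≈x
      cover′ (there v∈xs) v≈v with rep-cover v∈xs v≈v
      ... | i , rᵢ≈v = suc i , rᵢ≈v

  representatives : ∀ xs → Representatives xs
  representatives [] = record
    { k = 0 ; rep = λ () ; rep-refl = λ () ; rep-apart = λ () ; rep-cover = λ () }
  representatives (x ∷ xs) with representatives xs
  ... | reps with x ≈? x | any? (λ i → Representatives.rep reps i ≈? x)
  ... | no x≉x  | _             = keep-representatives reps x (⊥-elim ∘ x≉x)
  ... | yes _   | yes x-covered = keep-representatives reps x (λ _ → x-covered)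
  ... | yes x≈x | no x-new      = add-representative reps x x≈x x-new

  open Representatives (representatives (allFin n)) public

  class-nonempty : ∀ i → Nonempty (class (rep i))
  class-nonempty i = rep i , from ∈-class (rep-refl i)

  class-disjoint : ∀ i j v → i ≢ j → v ∈ class (rep i) → v ∉ class (rep j)
  class-disjoint i j v i≢j v∈i v∈j =
    rep-apart i j i≢j (trans (to ∈-class v∈i) (sym (to ∈-class v∈j)))

  class-cover : ∀ v → v ≈ v ⇔ ∃ λ i → v ∈ class (rep i)
  class-cover v = mk⇔ find-class (λ (i , v∈i) → let r≈v = to ∈-class v∈i in trans (sym r≈v) r≈v)
    where
    find-class : v ≈ v → ∃ λ i → v ∈ class (rep i)
    find-class v≈v with rep-cover (∈-allFin v) v≈v
    ... | i , r≈v = i , from ∈-class r≈v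

module _ {A : Set} {R : Rel A 0ℓ} where

  allPairs-++⁻ˡ : ∀ xs {ys} → AllPairs R (xs ++ ys) → AllPairs R xs
  allPairs-++⁻ˡ []       _          = []
  allPairs-++⁻ˡ (x ∷ xs) (px ∷ pxs) = All.++⁻ˡ xs px ∷ allPairs-++⁻ˡ xs pxs

  allPairs-++⁻ʳ : ∀ xs {ys} → AllPairs R (xs ++ ys) → AllPairs R ys
  allPairs-++⁻ʳ []       pxs       = pxs
  allPairs-++⁻ʳ (x ∷ xs) (_ ∷ pxs) = allPairs-++⁻ʳ xs pxs

  linked-tail : ∀ {x xs} → Linked R (x ∷ xs) → Linked R xs
  linked-tail [-]        = []
  linked-tail (_ ∷ rxs) = rxs

  linked-++⁻ˡ : ∀ xs {ys} → Linked R (xs ++ ys) → Linked R xs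
  linked-++⁻ˡ []           _          = []
  linked-++⁻ˡ (x ∷ [])     _          = [-]
  linked-++⁻ˡ (x ∷ y ∷ xs) (rxy ∷ rs) = rxy ∷ linked-++⁻ˡ (y ∷ xs) rs

  linked-++⁻ʳ : ∀ xs {ys} → Linked R (xs ++ ys) → Linked R ys
  linked-++⁻ʳ []       rs = rs
  linked-++⁻ʳ (x ∷ xs) rs = linked-++⁻ʳ xs (linked-tail rs)

module _ {n : ℕ} (arc : Graph n) where

  adj-sym : ∀ {u v} → Adj arc u v → Adj arc v u
  adj-sym (inj₁ u→v) = inj₂ u→v
  adj-sym (inj₂ v→u) = inj₁ v→u

  adj? : B.Decidable (Adj arc)
  adj? u v = T? (arc u v) ⊎-dec T? (arc v u)

  connIn-trans : ∀ {S u w v} → ConnIn arc S u w → ConnIn arc S w v → ConnIn arc S u v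
  connIn-trans here            c = c
  connIn-trans (step a w∈S c′) c = step a w∈S (connIn-trans c′ c)

  connIn-sym : ∀ {S u v} → u ∈ S → ConnIn arc S u v → ConnIn arc S v u
  connIn-sym u∈S here           = here
  connIn-sym u∈S (step a w∈S c) = connIn-trans (connIn-sym w∈S c) (step (adj-sym a) u∈S here)

  connIn-∈ : ∀ {S u v} → u ∈ S → ConnIn arc S u v → v ∈ S
  connIn-∈ u∈S here           = u∈S
  connIn-∈ u∈S (step _ w∈S c) = connIn-∈ w∈S c

  connIn⇒walk : ∀ {S u v} → ConnIn arc S u v → u ≡ v ⊎ (v ∈ S × Walk (Adj arc) (_∈ S) u v)
  connIn⇒walk here = inj₁ refl
  connIn⇒walk (step a w∈S c) with connIn⇒walk c
  ... | inj₁ refl       = inj₂ (w∈S , [ a ])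
  ... | inj₂ (v∈S , ws) = inj₂ (v∈S , a ∷⟨ w∈S ⟩ ws)

  walk⇒connIn : ∀ {S u v} → v ∈ S → Walk (Adj arc) (_∈ S) u v → ConnIn arc S u v
  walk⇒connIn v∈S [ a ]            = step a v∈S here
  walk⇒connIn v∈S (a ∷⟨ w∈S ⟩ ws) = step a w∈S (walk⇒connIn v∈S ws)

  connIn? : ∀ S → B.Decidable (ConnIn arc S)
  connIn? S u v = map′ fromWalk connIn⇒walk
    ((u ≟ v) ⊎-dec ((v ∈? S) ×-dec walk? adj? (_∈? S) u v))
    where
    fromWalk : u ≡ v ⊎ (v ∈ S × Walk (Adj arc) (_∈ S) u v) → ConnIn arc S u v
    fromWalk (inj₁ refl)       = here
    fromWalk (inj₂ (v∈S , ws)) = walk⇒connIn v∈S ws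

  ActiveTrail : List (Fin n) → Set
  ActiveTrail t = IsTrail arc t × NoConverging arc t

  noConverging-tail : ∀ {x xs} → NoConverging arc (x ∷ xs) → NoConverging arc xs
  noConverging-tail {xs = []}         _        = tt
  noConverging-tail {xs = y ∷ []}     _        = tt
  noConverging-tail {xs = y ∷ z ∷ xs} (_ , nc) = nc

  noConverging-++⁻ˡ : ∀ xs {ys} → NoConverging arc (xs ++ ys) → NoConverging arc xs
  noConverging-++⁻ˡ []               _         = tt
  noConverging-++⁻ˡ (x ∷ [])         _         = tt
  noConverging-++⁻ˡ (x ∷ y ∷ [])     _         = tt
  noConverging-++⁻ˡ (x ∷ y ∷ z ∷ xs) (¬c , nc) = ¬c , noConverging-++⁻ˡ (y ∷ z ∷ xs) nc

  noConverging-++⁻ʳ : ∀ xs {ys} → NoConverging arc (xs ++ ys) → NoConverging arc ys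
  noConverging-++⁻ʳ []       nc = nc
  noConverging-++⁻ʳ (x ∷ xs) nc = noConverging-++⁻ʳ xs (noConverging-tail nc)

  activeTrail-++⁻ˡ : ∀ xs {ys} → ActiveTrail (xs ++ ys) → ActiveTrail xs
  activeTrail-++⁻ˡ xs ((uniq , linked) , nc) =
    (allPairs-++⁻ˡ xs uniq , linked-++⁻ˡ xs linked) , noConverging-++⁻ˡ xs nc

  activeTrail-++⁻ʳ : ∀ xs {ys} → ActiveTrail (xs ++ ys) → ActiveTrail ys
  activeTrail-++⁻ʳ xs ((uniq , linked) , nc) =
    (allPairs-++⁻ʳ xs uniq , linked-++⁻ʳ xs linked) , noConverging-++⁻ʳ xs nc

  module Components (K : Subset n) where

    SameComponent : Rel (Fin n) 0ℓ
    SameComponent u v = u ∈ K × ConnIn arc K u v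

    sameComponent-sym : ∀ {u v} → SameComponent u v → SameComponent v u
    sameComponent-sym (u∈K , c) = connIn-∈ u∈K c , connIn-sym u∈K c

    sameComponent-trans : ∀ {u w v} → SameComponent u w → SameComponent w v → SameComponent u v
    sameComponent-trans (u∈K , c) (_ , c′) = u∈K , connIn-trans c c′

    sameComponent-isPER : IsPartialEquivalence SameComponent
    sameComponent-isPER = record { sym = sameComponent-sym ; trans = sameComponent-trans }

    sameComponent? : B.Decidable SameComponent
    sameComponent? u v = (u ∈? K) ×-dec connIn? K u v

    open Classes sameComponent-isPER sameComponent? public
      renaming ( class to component ; ∈-class to ∈-component ; class-nonempty to component-nonempty
               ; class-disjoint to component-disjoint ; class-cover to component-cover )

    component⊆K : ∀ {r v} → v ∈ component r → v ∈ K
    component⊆K v∈C = proj₁ (sameComponent-sym (to ∈-component v∈C))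

    connIn-component : ∀ {r u v} → SameComponent r u → ConnIn arc K u v →
                       ConnIn arc (component r) u v
    connIn-component     r~u here = here
    connIn-component {r} r~u (step {w = w} a w∈K c) =
      step a (from ∈-component r~w) (connIn-component r~w c)
      where
      r~w : SameComponent r w
      r~w = proj₁ r~u , connIn-trans (proj₂ r~u) (step a w∈K here)

    component-connected : ∀ r → Connected arc (component r)
    component-connected r u v u∈C v∈C =
      connIn-component r~u (proj₂ (sameComponent-trans (sameComponent-sym r~u) r~v))
      where
      r~u : SameComponent r u
      r~u = to ∈-component u∈C
      r~v : SameComponent r v
      r~v = to ∈-component v∈C

    module _ (lr : LocalRelationships arc K) where

      -- mid is the K-free stretch of the trail since the last node of K, which is a.
      activeTrail-connected : ∀ {a} → a ∈ K → ∀ mid rest → All (_∉ K) mid →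
        ActiveTrail (a ∷ mid ++ rest) → All (λ x → x ∈ K → ConnIn arc K a x) rest
      activeTrail-connected a∈K mid [] _ _ = []
      activeTrail-connected {a} a∈K mid (b ∷ rest) mid∉K act = next (b ∈? K)
        where
        act′ : ActiveTrail (a ∷ (mid ∷ʳ b) ++ rest)
        act′ = subst ActiveTrail (cong (a ∷_) (≡.sym (∷ʳ-++ mid b rest))) act

        next : Dec (b ∈ K) → All (λ x → x ∈ K → ConnIn arc K a x) (b ∷ rest)
        next (no b∉K) =
          (⊥-elim ∘ b∉K) ∷ activeTrail-connected a∈K (mid ∷ʳ b) rest (All.∷ʳ⁺ mid∉K b∉K) act′
        next (yes b∈K) =
          (λ _ → a~b) ∷ All.map (connIn-trans a~b ∘_)
            (activeTrail-connected b∈K [] rest [] (activeTrail-++⁻ʳ (a ∷ mid) act))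
          where
          a⋯b : ActiveTrail (a ∷ mid ∷ʳ b)
          a⋯b = activeTrail-++⁻ˡ (a ∷ mid ∷ʳ b) act′
          a~b : ConnIn arc K a b
          a~b = step (lr a b mid a∈K b∈K (proj₁ a⋯b) (proj₂ a⋯b) mid∉K) b∈K here

      activeTrail-in-component : ∀ {r a ys} → a ∈ component r → ActiveTrail (a ∷ ys) →
        All (λ x → x ∈ K → x ∈ component r) ys
      activeTrail-in-component {r} {a} {ys} a∈C act =
        All.map (λ a~x x∈K → from ∈-component (sameComponent-trans r~a (a∈K , a~x x∈K)))
                (activeTrail-connected a∈K [] ys [] act)
        where
        r~a : SameComponent r a
        r~a = to ∈-component a∈C
        a∈K : a ∈ K
        a∈K = component⊆K a∈C

      component-localRelationships : ∀ r → LocalRelationships arc (component r)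
      component-localRelationships r v₁ v₂ xs v₁∈C v₂∈C tr nc xs∉C =
        lr v₁ v₂ xs (component⊆K v₁∈C) (component⊆K v₂∈C) tr nc
          (All.zipWith (λ (∈K⇒∈C , ∉C) → ∉C ∘ ∈K⇒∈C)
                       (All.++⁻ˡ xs (activeTrail-in-component v₁∈C (tr , nc)) , xs∉C))

      components-dSeparated : ∀ i j → i ≢ j → DSepEmpty arc (component (rep i)) (component (rep j))
      components-dSeparated i j i≢j a b xs a∈Cᵢ b∈Cⱼ tr nc =
        component-disjoint i j b i≢j
          (All.head (All.++⁻ʳ xs (activeTrail-in-component a∈Cᵢ (tr , nc))) (component⊆K b∈Cⱼ))
          b∈Cⱼ

      decomposition : ∃₂ λ (k : ℕ) (Ks : Fin k → Subset n) →
        IsPartition arc K k Ks ×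
        (∀ i → Connected arc (Ks i) × LocalRelationships arc (Ks i)) ×
        (∀ i j → i ≢ j → DSepEmpty arc (Ks i) (Ks j))
      decomposition =
        k , component ∘ rep ,
        (component-nonempty , component-disjoint , cover) ,
        (λ i → component-connected (rep i) , component-localRelationships (rep i)) ,
        components-dSeparated
        where
        cover : ∀ v → v ∈ K ⇔ ∃ λ i → v ∈ component (rep i)
        cover v = mk⇔ (to (component-cover v) ∘ (_, here))
                      (proj₁ ∘ from (component-cover v))

  localRelationships-fromBlocks : ∀ {K k} {Ks : Fin k → Subset n} →
    (∀ v → v ∈ K ⇔ ∃ λ i → v ∈ Ks i) →
    (∀ i → LocalRelationships arc (Ks i)) →
    (∀ i j → i ≢ j → DSepEmpty arc (Ks i) (Ks j)) →
    LocalRelationships arc K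
  localRelationships-fromBlocks cover lrs dsep v₁ v₂ xs v₁∈K v₂∈K tr nc xs∉K
    with to (cover v₁) v₁∈K | to (cover v₂) v₂∈K
  ... | i , v₁∈Kᵢ | j , v₂∈Kⱼ with i ≟ j
  ... | no i≢j  = ⊥-elim (dsep i j i≢j v₁ v₂ xs v₁∈Kᵢ v₂∈Kⱼ tr nc)
  ... | yes refl = lrs i v₁ v₂ xs v₁∈Kᵢ v₂∈Kⱼ tr nc
                     (All.map (λ x∉K x∈Kᵢ → x∉K (from (cover _) (i , x∈Kᵢ))) xs∉K)

proposition5p3 : (n : ℕ) (arc : Graph n) → Acyclic arc → (K : Subset n) →
    LocalRelationships arc K ⇔
      ∃₂ λ (k : ℕ) (Ks : Fin k → Subset n) →
        IsPartition arc K k Ks ×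
        (∀ i → Connected arc (Ks i) × LocalRelationships arc (Ks i)) ×
        (∀ i j → i ≢ j → DSepEmpty arc (Ks i) (Ks j))
proposition5p3 n arc _ K = mk⇔ decomposition
  (λ (_ , _ , (_ , _ , cover) , blocks , dsep) →
     localRelationships-fromBlocks arc cover (proj₂ ∘ blocks) dsep)
  where open Components arc K
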